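{- There exists a matrix space which is in the Edmonds-Rado class but is not a compression space.
   Context: For a matrix space $\mathcal{B}\leq M(n,\mathbb{F})$ and $U\leq\mathbb{F}^n$, $\mathcal{B}(U)=\langle B(u):B\in\mathcal{B},u\in U\rangle$; $U$ is a $c$-singularity witness if $\dim U-\dim\mathcal{B}(U)\geq c$; $\mathrm{disc}(\mathcal{B})$ is the largest $c$ for which a $c$-singularity witness exists, and $\mathrm{cork}(\mathcal{B})=n-\max_{B\in\mathcal{B}}\mathrm{rk}(B)$. $\mathcal{B}$ is in the Edmonds-Rado class if it contains a nonsingular matrix or has a $c$-singularity witness for some $c>0$ (equivalently, $\mathrm{disc}(\mathcal{B})=0$ iff $\mathrm{cork}(\mathcal{B})=0$). $\mathcal{B}$ is a compression space if $\mathrm{cork}(\mathcal{B})=\mathrm{disc}(\mathcal{B})$. -}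

module Defs where

open import Level using (0ℓ; Lift) renaming (suc to lsuc)
open import Data.Nat using (ℕ; zero; suc) renaming (_+_ to _+ℕ_; _≤_ to _≤ℕ_; _∸_ to _∸ℕ_; _>_ to _>ℕ_)
open import Data.Fin using (Fin; zero; suc)
open import Data.Product using (Σ; ∃; _×_; _,_)
open import Data.Sum using (_⊎_)
open import Relation.Nullary using (¬_)
open import Relation.Binary.PropositionalEquality using (_≡_)
open import Algebra.Bundles using (CommutativeRing)

record Field : Set₁ where
  field
    commRing : CommutativeRing 0ℓ 0ℓ
  open CommutativeRing commRing public
  field
    0≉1     : ¬ (0# ≈ 1#)
    inverse : ∀ x → ¬ (x ≈ 0#) → Σ Carrier (λ y → x * y ≈ 1#)

module LinAlg (F : Field) where
  open Field F using (Carrier; _≈_; _+_; _*_; 0#; 1#)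

  Vec : ℕ → Set
  Vec n = Fin n → Carrier

  Mat : ℕ → Set
  Mat n = Fin n → Fin n → Carrier

  ∑ : ∀ {k} → (Fin k → Carrier) → Carrier
  ∑ {zero}  f = 0#
  ∑ {suc k} f = f zero + ∑ (λ i → f (suc i))

  _≈ᵥ_ : ∀ {n} → Vec n → Vec n → Set
  v ≈ᵥ w = ∀ i → v i ≈ w i

  0ᵥ : ∀ {n} → Vec n
  0ᵥ _ = 0#

  _+ᵥ_ : ∀ {n} → Vec n → Vec n → Vec n
  (v +ᵥ w) i = v i + w i

  _·ᵥ_ : ∀ {n} → Carrier → Vec n → Vec n
  (a ·ᵥ v) i = a * v i

  _≈ₘ_ : ∀ {n} → Mat n → Mat n → Set
  A ≈ₘ B = ∀ i j → A i j ≈ B i j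

  0ₘ : ∀ {n} → Mat n
  0ₘ _ _ = 0#

  _+ₘ_ : ∀ {n} → Mat n → Mat n → Mat n
  (A +ₘ B) i j = A i j + B i j

  _·ₘ_ : ∀ {n} → Carrier → Mat n → Mat n
  (a ·ₘ A) i j = a * A i j

  _⟨$⟩_ : ∀ {n} → Mat n → Vec n → Vec n
  (A ⟨$⟩ v) i = ∑ (λ j → A i j * v j)

  lincomb : ∀ {n k} → (Fin k → Carrier) → (Fin k → Vec n) → Vec n
  lincomb c v j = ∑ (λ i → c i * v i j)

  VSet : ℕ → Set₁
  VSet n = Vec n → Set

  record IsSubspace {n} (U : VSet n) : Set where
    field
      resp   : ∀ {v w} → v ≈ᵥ w → U v → U w
      zero∈  : U 0ᵥ
      +-closed : ∀ {v w} → U v → U w → U (v +ᵥ w)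
      ·-closed : ∀ a {v} → U v → U (a ·ᵥ v)

  record IsMatrixSpace {n} (𝓑 : Mat n → Set) : Set where
    field
      resp   : ∀ {A B} → A ≈ₘ B → 𝓑 A → 𝓑 B
      zero∈  : 𝓑 0ₘ
      +-closed : ∀ {A B} → 𝓑 A → 𝓑 B → 𝓑 (A +ₘ B)
      ·-closed : ∀ a {A} → 𝓑 A → 𝓑 (a ·ₘ A)

  Span : ∀ {n} → VSet n → VSet n
  Span {n} S w = Σ ℕ λ k → Σ (Fin k → Vec n) λ v →
    (∀ i → S (v i)) × Σ (Fin k → Carrier) (λ c → w ≈ᵥ lincomb c v)

  LinIndep : ∀ {n k} → (Fin k → Vec n) → Set
  LinIndep v = ∀ c → lincomb c v ≈ᵥ 0ᵥ → ∀ i → c i ≈ 0#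

  HasIndep : ∀ {n} → VSet n → ℕ → Set
  HasIndep {n} W k = Σ (Fin k → Vec n) λ v → (∀ i → W (v i)) × LinIndep v

  IsDim : ∀ {n} → VSet n → ℕ → Set
  IsDim W d = HasIndep W d × ¬ HasIndep W (suc d)

  Image : ∀ {n} → Mat n → VSet n
  Image {n} A w = Σ (Vec n) λ v → w ≈ᵥ (A ⟨$⟩ v)

  IsRank : ∀ {n} → Mat n → ℕ → Set
  IsRank A r = IsDim (Image A) r

  Nonsingular : ∀ {n} → Mat n → Set
  Nonsingular {n} A = ∀ v → (A ⟨$⟩ v) ≈ᵥ 0ᵥ → v ≈ᵥ 0ᵥ

  Apply : ∀ {n} → (Mat n → Set) → VSet n → VSet n
  Apply {n} 𝓑 U = Span (λ w → Σ (Mat n) λ B → Σ (Vec n) λ u →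
                          𝓑 B × U u × w ≈ᵥ (B ⟨$⟩ u))

  IsWitness : ∀ {n} → (Mat n → Set) → VSet n → ℕ → Set
  IsWitness 𝓑 U c = IsSubspace U × Σ ℕ λ du → Σ ℕ λ db →
    IsDim U du × IsDim (Apply 𝓑 U) db × (db +ℕ c ≤ℕ du)

  HasWitness : ∀ {n} → (Mat n → Set) → ℕ → Set₁
  HasWitness {n} 𝓑 c = Σ (VSet n) λ U → IsWitness 𝓑 U c

  IsDisc : ∀ {n} → (Mat n → Set) → ℕ → Set₁
  IsDisc 𝓑 c = HasWitness 𝓑 c × (∀ c' → HasWitness 𝓑 c' → c' ≤ℕ c)

  IsMaxRank : ∀ {n} → (Mat n → Set) → ℕ → Set
  IsMaxRank {n} 𝓑 r = (Σ (Mat n) λ B → 𝓑 B × IsRank B r)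
                    × (∀ B r' → 𝓑 B → IsRank B r' → r' ≤ℕ r)

  IsCork : ∀ {n} → (Mat n → Set) → ℕ → Set
  IsCork {n} 𝓑 k = Σ ℕ λ r → IsMaxRank 𝓑 r × k ≡ n ∸ℕ r

  EdmondsRado : ∀ {n} → (Mat n → Set) → Set₁
  EdmondsRado {n} 𝓑 = Lift (lsuc 0ℓ) (Σ (Mat n) λ B → 𝓑 B × Nonsingular B)
                    ⊎ (Σ ℕ λ c → c >ℕ 0 × HasWitness 𝓑 c)

  IsCompression : ∀ {n} → (Mat n → Set) → Set₁
  IsCompression 𝓑 = ∀ k c → IsCork 𝓑 k → IsDisc 𝓑 c → k ≡ c

-- Over GF(2) take 𝓐, the alternating 3×3 matrices padded by a zero fourth row and
-- column. Such a matrix alt a b c is symmetric and kills (c, b, a, 0), so its image is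
-- orthogonal to that vector and has dimension at most 2; as E₀₁ has rank 2, cork 𝓐 = 2.
-- Every matrix of 𝓐 kills the line ⟨e₃⟩, a 1-singularity witness, so 𝓐 is in the
-- Edmonds-Rado class. But 𝓐 shrinks no subspace U by more than one dimension: if
-- dim U ≥ 2, some u ∈ U has a nonzero entry among its first three coordinates, and two
-- of E₀₁ u, E₀₂ u, E₁₂ u are independent; if dim U = 4, then 𝓐(U) ∋ e₀, e₁, e₂.
-- Hence disc 𝓐 = 1 ≠ cork 𝓐.
module Submission where

open import Defs
open import Data.Bool using (Bool; true; false; _∧_; _xor_)
open import Data.Bool.Properties
  using (xor-∧-commutativeRing; ¬-not; ∧-identityʳ; ∧-zeroʳ; ∧-assoc; ∧-distribʳ-xor; xor-same; xor-identityʳ)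
import Data.Bool.Properties as Bool
open import Data.Empty using (⊥-elim)
open import Data.Fin using (Fin; zero; suc; punchIn; punchOut; _≟_)
open import Data.Fin.Patterns using (0F; 1F; 2F; 3F)
open import Data.Fin.Properties using (any?; punchIn-punchOut)
open import Data.Maybe using (just; nothing)
open import Data.Nat using (ℕ; zero; suc; _≤_; _<_; _≤′_; ≤′-refl; ≤′-step; s≤s; z≤n)
open import Data.Nat.Properties using (1+n≢n; ≤-refl; ≤-trans; ≤-reflexive; +-cancelˡ-≤; ≤⇒≤′; ≮⇒≥)
import Data.Nat.Properties as ℕ
open import Data.Product using (Σ; ∃; _×_; _,_; proj₁; proj₂)
open import Data.Sum using (_⊎_; inj₁; inj₂; [_,_]′)
open import Data.Vec.Functional using (_∷_; [])
open import Function using (_∘_)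
open import Relation.Nullary using (¬_; yes; no; contradiction)
open import Relation.Binary.PropositionalEquality using (_≡_)
import Relation.Binary.PropositionalEquality as ≡
open import Tactic.RingSolver using (solve-∀)
open import Tactic.RingSolver.Core.AlmostCommutativeRing using (AlmostCommutativeRing; fromCommutativeRing)

module LinAlgProperties (F : Field) where
  open Field F hiding (zero)
  open LinAlg F
  open import Algebra.Properties.CommutativeMonoid.Sum +-commutativeMonoid
    using (sum; sum-cong-≋; ∑-distrib-+; ∑-comm; sum-replicate-zero)
  open import Algebra.Properties.Semiring.Sum semiring using (*-distribˡ-sum; *-distribʳ-sum)
  open import Algebra.Properties.CommutativeSemigroup *-commutativeSemigroup using (x∙yz≈y∙xz)
  open import Relation.Binary.Reasoning.Setoid setoid

  ∑≡sum : ∀ {k} (f : Fin k → Carrier) → ∑ f ≡ sum f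
  ∑≡sum {zero}  f = ≡.refl
  ∑≡sum {suc k} f = ≡.cong (f zero +_) (∑≡sum (f ∘ suc))

  ∑-cong : ∀ {k} {f g : Fin k → Carrier} → (∀ i → f i ≈ g i) → ∑ f ≈ ∑ g
  ∑-cong {f = f} {g} f≈g = begin
    ∑ f   ≡⟨ ∑≡sum f ⟩
    sum f ≈⟨ sum-cong-≋ f≈g ⟩
    sum g ≡⟨ ∑≡sum g ⟨
    ∑ g   ∎

  ∑-zero : ∀ {k} {f : Fin k → Carrier} → (∀ i → f i ≈ 0#) → ∑ f ≈ 0#
  ∑-zero {k} {f} f≈0 = begin
    ∑ f                  ≈⟨ ∑-cong f≈0 ⟩
    ∑ {k} (λ _ → 0#)     ≡⟨ ∑≡sum {k} (λ _ → 0#) ⟩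
    sum {k} (λ _ → 0#)   ≈⟨ sum-replicate-zero k ⟩
    0#                   ∎

  ∑-+ : ∀ {k} (f g : Fin k → Carrier) → ∑ (λ i → f i + g i) ≈ ∑ f + ∑ g
  ∑-+ f g = begin
    ∑ (λ i → f i + g i)   ≡⟨ ∑≡sum (λ i → f i + g i) ⟩
    sum (λ i → f i + g i) ≈⟨ ∑-distrib-+ f g ⟩
    sum f + sum g         ≡⟨ ≡.cong₂ _+_ (∑≡sum f) (∑≡sum g) ⟨
    ∑ f + ∑ g             ∎

  *-∑ : ∀ {k} x (f : Fin k → Carrier) → x * ∑ f ≈ ∑ (λ i → x * f i)
  *-∑ x f = begin
    x * ∑ f               ≡⟨ ≡.cong (x *_) (∑≡sum f) ⟩
    x * sum f             ≈⟨ *-distribˡ-sum x f ⟩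
    sum (λ i → x * f i)   ≡⟨ ∑≡sum (λ i → x * f i) ⟨
    ∑ (λ i → x * f i)     ∎

  ∑-* : ∀ {k} x (f : Fin k → Carrier) → ∑ f * x ≈ ∑ (λ i → f i * x)
  ∑-* x f = begin
    ∑ f * x               ≡⟨ ≡.cong (_* x) (∑≡sum f) ⟩
    sum f * x             ≈⟨ *-distribʳ-sum x f ⟩
    sum (λ i → f i * x)   ≡⟨ ∑≡sum (λ i → f i * x) ⟨
    ∑ (λ i → f i * x)     ∎

  ∑-swap : ∀ {k m} (f : Fin k → Fin m → Carrier) →
           ∑ (λ i → ∑ (λ j → f i j)) ≈ ∑ (λ j → ∑ (λ i → f i j))
  ∑-swap f = begin
    ∑ (λ i → ∑ (f i))               ≈⟨ ∑-cong (λ i → reflexive (∑≡sum (f i))) ⟩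
    ∑ (λ i → sum (f i))             ≡⟨ ∑≡sum (λ i → sum (f i)) ⟩
    sum (λ i → sum (f i))           ≈⟨ ∑-comm f ⟩
    sum (λ j → sum (λ i → f i j))   ≡⟨ ∑≡sum (λ j → sum (λ i → f i j)) ⟨
    ∑ (λ j → sum (λ i → f i j))     ≈⟨ ∑-cong (λ j → reflexive (∑≡sum (λ i → f i j))) ⟨
    ∑ (λ j → ∑ (λ i → f i j))       ∎

  δ : ∀ {n} → Fin n → Fin n → Carrier
  δ zero    zero    = 1#
  δ zero    (suc _) = 0#
  δ (suc _) zero    = 0#
  δ (suc i) (suc j) = δ i j

  e : ∀ {n} → Fin n → Vec n
  e = δ

  δ-sym : ∀ {n} (i j : Fin n) → δ i j ≈ δ j i
  δ-sym zero    zero    = refl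
  δ-sym zero    (suc _) = refl
  δ-sym (suc _) zero    = refl
  δ-sym (suc i) (suc j) = δ-sym i j

  ∑-δ : ∀ {n} (x : Vec n) j → ∑ (λ i → x i * δ i j) ≈ x j
  ∑-δ x zero = begin
    x zero * 1# + ∑ (λ i → x (suc i) * 0#) ≈⟨ +-cong (*-identityʳ (x zero)) (∑-zero (λ i → zeroʳ (x (suc i)))) ⟩
    x zero + 0#                            ≈⟨ +-identityʳ _ ⟩
    x zero                                 ∎
  ∑-δ x (suc j) = begin
    x zero * 0# + ∑ (λ i → x (suc i) * δ i j) ≈⟨ +-cong (zeroʳ _) (∑-δ (x ∘ suc) j) ⟩
    0# + x (suc j)                            ≈⟨ +-identityˡ _ ⟩
    x (suc j)                                 ∎

  ∑-δˡ : ∀ {n} (x : Vec n) j → ∑ (λ i → δ j i * x i) ≈ x j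
  ∑-δˡ x j = trans (∑-cong (λ i → trans (*-comm (δ j i) (x i)) (*-congˡ (δ-sym j i)))) (∑-δ x j)

  lincomb-basis : ∀ {n} (x : Vec n) → lincomb x e ≈ᵥ x
  lincomb-basis x = ∑-δ x

  lincomb-δ : ∀ {n k} (w : Fin k → Vec n) j → lincomb (δ j) w ≈ᵥ w j
  lincomb-δ w j l = ∑-δˡ (λ i → w i l) j

  lincomb-congʳ : ∀ {n k} (c : Fin k → Carrier) {v w : Fin k → Vec n} →
                  (∀ i → v i ≈ᵥ w i) → lincomb c v ≈ᵥ lincomb c w
  lincomb-congʳ c v≈w l = ∑-cong (λ i → *-congˡ (v≈w i l))

  lincomb-zeroˡ : ∀ {n k} {c : Fin k → Carrier} (w : Fin k → Vec n) →
                  (∀ i → c i ≈ 0#) → lincomb c w ≈ᵥ 0ᵥ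
  lincomb-zeroˡ w c≈0 l = ∑-zero (λ i → trans (*-congʳ (c≈0 i)) (zeroˡ (w i l)))

  lincomb-zeroʳ : ∀ {n k} (c : Fin k → Carrier) {w : Fin k → Vec n} →
                  (∀ i → w i ≈ᵥ 0ᵥ) → lincomb c w ≈ᵥ 0ᵥ
  lincomb-zeroʳ c w≈0 l = ∑-zero (λ i → trans (*-congˡ (w≈0 i l)) (zeroʳ (c i)))

  lincomb-assoc : ∀ {n k m} (c : Fin k → Carrier) (C : Fin k → Vec m) (w : Fin m → Vec n) →
                  lincomb c (λ i → lincomb (C i) w) ≈ᵥ lincomb (lincomb c C) w
  lincomb-assoc c C w l = begin
    ∑ (λ i → c i * ∑ (λ j → C i j * w j l))   ≈⟨ ∑-cong (λ i → *-∑ (c i) (λ j → C i j * w j l)) ⟩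
    ∑ (λ i → ∑ (λ j → c i * (C i j * w j l))) ≈⟨ ∑-cong (λ i → ∑-cong (λ j → sym (*-assoc (c i) (C i j) (w j l)))) ⟩
    ∑ (λ i → ∑ (λ j → c i * C i j * w j l))   ≈⟨ ∑-swap (λ i j → c i * C i j * w j l) ⟩
    ∑ (λ j → ∑ (λ i → c i * C i j * w j l))   ≈⟨ ∑-cong (λ j → sym (∑-* (w j l) (λ i → c i * C i j))) ⟩
    ∑ (λ j → ∑ (λ i → c i * C i j) * w j l)   ∎

  _∙_ : ∀ {n} → Vec n → Vec n → Carrier
  x ∙ y = ∑ (λ l → x l * y l)

  lincomb-shear : ∀ {n k} (d s : Fin k → Carrier) (w : Vec n) (u : Fin k → Vec n) →
                  lincomb d (λ i → u i +ᵥ (s i ·ᵥ w)) ≈ᵥ lincomb ((d ∙ s) ∷ d) (w ∷ u)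
  lincomb-shear d s w u l = begin
    ∑ (λ i → d i * (u i l + s i * w l))            ≈⟨ ∑-cong (λ i → trans (distribˡ (d i) (u i l) (s i * w l))
                                                                          (+-congˡ (sym (*-assoc (d i) (s i) (w l))))) ⟩
    ∑ (λ i → d i * u i l + d i * s i * w l)        ≈⟨ ∑-+ (λ i → d i * u i l) (λ i → d i * s i * w l) ⟩
    lincomb d u l + ∑ (λ i → d i * s i * w l)      ≈⟨ +-congˡ (∑-* (w l) (λ i → d i * s i)) ⟨
    lincomb d u l + (d ∙ s) * w l                  ≈⟨ +-comm _ _ ⟩
    (d ∙ s) * w l + lincomb d u l                  ∎

  ∙-basis : ∀ {n} (x : Vec n) j → x ∙ e j ≈ x j
  ∙-basis x j = trans (∑-cong (λ l → *-congˡ {x l} (δ-sym j l))) (∑-δ x j)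

  orthogonal-isSubspace : ∀ {n} (k : Vec n) → IsSubspace (λ x → k ∙ x ≈ 0#)
  orthogonal-isSubspace k = record
    { resp     = λ v≈w k∙v≈0 → trans (∑-cong (λ l → *-congˡ (sym (v≈w l)))) k∙v≈0
    ; zero∈    = ∑-zero (λ l → zeroʳ (k l))
    ; +-closed = λ {v} {w} k∙v≈0 k∙w≈0 → begin
        ∑ (λ l → k l * (v l + w l))       ≈⟨ ∑-cong (λ l → distribˡ (k l) (v l) (w l)) ⟩
        ∑ (λ l → k l * v l + k l * w l)   ≈⟨ ∑-+ (λ l → k l * v l) (λ l → k l * w l) ⟩
        k ∙ v + k ∙ w                     ≈⟨ +-cong k∙v≈0 k∙w≈0 ⟩
        0# + 0#                           ≈⟨ +-identityˡ _ ⟩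
        0#                                ∎
    ; ·-closed = λ a {v} k∙v≈0 → begin
        ∑ (λ l → k l * (a * v l))   ≈⟨ ∑-cong (λ l → x∙yz≈y∙xz (k l) a (v l)) ⟩
        ∑ (λ l → a * (k l * v l))   ≈⟨ *-∑ a (λ l → k l * v l) ⟨
        a * (k ∙ v)                 ≈⟨ *-congˡ k∙v≈0 ⟩
        a * 0#                      ≈⟨ zeroʳ _ ⟩
        0#                          ∎
    }

  pivots⇒linIndep : ∀ {n k} (v : Fin k → Vec n) (p : Fin k → Fin n) →
                    (∀ i j → v i (p j) ≈ δ i j) → LinIndep v
  pivots⇒linIndep v p v≈δ c lincomb≈0 j = begin
    c j                       ≈⟨ ∑-δ c j ⟨
    ∑ (λ i → c i * δ i j)     ≈⟨ ∑-cong (λ i → *-congˡ {c i} (v≈δ i j)) ⟨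
    lincomb c v (p j)         ≈⟨ lincomb≈0 (p j) ⟩
    0#                        ∎

  linIndep⇒≉0ᵥ : ∀ {n k} {v : Fin k → Vec n} → LinIndep v → ∀ i → ¬ (v i ≈ᵥ 0ᵥ)
  linIndep⇒≉0ᵥ {v = v} indep i vᵢ≈0 = 0≉1 (sym (begin
    1#       ≡⟨ δ-diag i ⟨
    δ i i    ≈⟨ indep (δ i) (λ l → trans (lincomb-δ v i l) (vᵢ≈0 l)) i ⟩
    0#       ∎))
    where
    δ-diag : ∀ {n} (i : Fin n) → δ i i ≡ 1#
    δ-diag zero    = ≡.refl
    δ-diag (suc i) = δ-diag i

  ∷-linIndep : ∀ {n k} {u : Vec n} {v : Fin k → Vec n} (j : Fin n) →
               u j ≈ 1# → (∀ i → v i j ≈ 0#) → LinIndep v → LinIndep (u ∷ v)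
  ∷-linIndep {u = u} {v} j uⱼ≈1 vᵢⱼ≈0 indep c rel = λ where
      zero    → c₀≈0
      (suc i) → indep (c ∘ suc) rest≈0 i
    where
    c₀≈0 : c zero ≈ 0#
    c₀≈0 = begin
      c zero                                  ≈⟨ *-identityʳ _ ⟨
      c zero * 1#                             ≈⟨ *-congˡ uⱼ≈1 ⟨
      c zero * u j                            ≈⟨ +-identityʳ _ ⟨
      c zero * u j + 0#                       ≈⟨ +-congˡ (∑-zero (λ i → trans (*-congˡ (vᵢⱼ≈0 i)) (zeroʳ (c (suc i))))) ⟨
      c zero * u j + lincomb (c ∘ suc) v j    ≈⟨ rel j ⟩
      0#                                      ∎
    rest≈0 : lincomb (c ∘ suc) v ≈ᵥ 0ᵥ
    rest≈0 l = begin
      lincomb (c ∘ suc) v l                   ≈⟨ +-identityˡ _ ⟨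
      0# + lincomb (c ∘ suc) v l              ≈⟨ +-congʳ (trans (*-congʳ c₀≈0) (zeroˡ (u l))) ⟨
      c zero * u l + lincomb (c ∘ suc) v l    ≈⟨ rel l ⟩
      0#                                      ∎

  hasIndep-zero : ∀ {n} {W : VSet n} → HasIndep W 0
  hasIndep-zero = (λ ()) , (λ ()) , λ _ _ ()

  hasIndep-pred : ∀ {n k} {W : VSet n} → HasIndep W (suc k) → HasIndep W k
  hasIndep-pred (v , v∈W , indep) = v ∘ suc , v∈W ∘ suc , λ c rel i →
    indep (0# ∷ c) (λ l → trans (+-congʳ (zeroˡ (v zero l))) (trans (+-identityˡ _) (rel l))) (suc i)

  hasIndep-antitone : ∀ {n j k} {W : VSet n} → j ≤ k → HasIndep W k → HasIndep W j
  hasIndep-antitone {W = W} = go ∘ ≤⇒≤′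
    where
    go : ∀ {j k} → j ≤′ k → HasIndep W k → HasIndep W j
    go ≤′-refl        h = h
    go (≤′-step j≤′k) h = go j≤′k (hasIndep-pred {W = W} h)

  hasIndep-bound : ∀ {n j d} {W : VSet n} → HasIndep W j → ¬ HasIndep W (suc d) → j ≤ d
  hasIndep-bound {W = W} h ¬h = ≮⇒≥ (λ d<j → ¬h (hasIndep-antitone {W = W} d<j h))

  ¬hasIndep-zeroSpace : ∀ {n} {W : VSet n} → (∀ {w} → W w → w ≈ᵥ 0ᵥ) → ¬ HasIndep W 1
  ¬hasIndep-zeroSpace W≈0 (v , v∈W , indep) = linIndep⇒≉0ᵥ {v = v} indep zero (W≈0 (v∈W zero))

  lincomb∈ : ∀ {n k} {U : VSet n} → IsSubspace U → (c : Fin k → Carrier) {v : Fin k → Vec n} →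
             (∀ i → U (v i)) → U (lincomb c v)
  lincomb∈ {k = zero}  U≤ c v∈U = IsSubspace.resp U≤ (λ _ → refl) (IsSubspace.zero∈ U≤)
  lincomb∈ {k = suc k} U≤ c v∈U = IsSubspace.resp U≤ (λ _ → refl)
    (IsSubspace.+-closed U≤ (IsSubspace.·-closed U≤ (c zero) (v∈U zero)) (lincomb∈ U≤ (c ∘ suc) (v∈U ∘ suc)))

  ⟨$⟩-congˡ : ∀ {n} {A B : Mat n} → A ≈ₘ B → ∀ x → (A ⟨$⟩ x) ≈ᵥ (B ⟨$⟩ x)
  ⟨$⟩-congˡ A≈B x i = ∑-cong (λ j → *-congʳ (A≈B i j))

  ⟨$⟩-≈0 : ∀ {n} {A : Mat n} {x : Vec n} → (∀ i j → A i j ≈ 0# ⊎ x j ≈ 0#) → (A ⟨$⟩ x) ≈ᵥ 0ᵥ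
  ⟨$⟩-≈0 {A = A} {x} 0-or-0 i = ∑-zero λ j → [ (λ Aᵢⱼ≈0 → trans (*-congʳ Aᵢⱼ≈0) (zeroˡ (x j)))
                                             , (λ xⱼ≈0 → trans (*-congˡ xⱼ≈0) (zeroʳ (A i j))) ]′ (0-or-0 i j)

  apply-∈ : ∀ {n} {𝓑 : Mat n → Set} {U : VSet n} {B u} → 𝓑 B → U u → Apply 𝓑 U (B ⟨$⟩ u)
  apply-∈ {B = B} {u} B∈𝓑 u∈U = 1 , (λ _ → B ⟨$⟩ u) , (λ _ → B , u , B∈𝓑 , u∈U , λ _ → refl) ,
    (λ _ → 1#) , λ l → sym (trans (+-identityʳ _) (*-identityˡ _))

  apply-≈0 : ∀ {n} {𝓑 : Mat n → Set} {U : VSet n} → (∀ {B u} → 𝓑 B → U u → (B ⟨$⟩ u) ≈ᵥ 0ᵥ) →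
             ∀ {w} → Apply 𝓑 U w → w ≈ᵥ 0ᵥ
  apply-≈0 kills (k , g , g∈ , c , w≈) l = trans (w≈ l) (lincomb-zeroʳ c gᵢ≈0 l)
    where
    gᵢ≈0 : ∀ i → g i ≈ᵥ 0ᵥ
    gᵢ≈0 i with g∈ i
    ... | B , u , B∈𝓑 , u∈U , gᵢ≈Bu = λ j → trans (gᵢ≈Bu j) (kills B∈𝓑 u∈U j)

  pivots⇒hasIndep-apply : ∀ {n k} {𝓑 : Mat n → Set} {U : VSet n} (B : Fin k → Mat n) (u : Fin k → Vec n) →
                          (∀ i → 𝓑 (B i)) → (∀ i → U (u i)) → (p : Fin k → Fin n) →
                          (∀ i j → (B i ⟨$⟩ u i) (p j) ≈ δ i j) → HasIndep (Apply 𝓑 U) k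
  pivots⇒hasIndep-apply B u B∈𝓑 u∈U p Bu≈δ =
    (λ i → B i ⟨$⟩ u i) , (λ i → apply-∈ (B∈𝓑 i) (u∈U i)) , pivots⇒linIndep _ p Bu≈δ

open import Relation.Binary.PropositionalEquality using (refl; sym; trans; cong; cong₂; subst; module ≡-Reasoning)

GF₂ : Field
GF₂ = record
  { commRing = xor-∧-commutativeRing
  ; 0≉1      = λ ()
  ; inverse  = λ { true _ → true , refl ; false 0≉0 → ⊥-elim (0≉0 refl) }
  }

𝔽₂ : AlmostCommutativeRing _ _
𝔽₂ = fromCommutativeRing xor-∧-commutativeRing λ where
  false → just refl
  true  → nothing

open LinAlg GF₂
open LinAlgProperties GF₂

LinDep : ∀ {n k} → (Fin k → Vec n) → Set
LinDep {k = k} v = Σ (Fin k → Bool) λ c → (∃ λ i → c i ≡ true) × lincomb c v ≈ᵥ 0ᵥ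

linDep⇒¬linIndep : ∀ {n k} {v : Fin k → Vec n} → LinDep v → ¬ LinIndep v
linDep⇒¬linIndep (c , (i , cᵢ≡1) , rel) indep with trans (sym cᵢ≡1) (indep c rel i)
... | ()

-- Gaussian elimination: with a pivot v₀ⱼ₀ = 1, clear column j₀ from the other rows,
-- delete it and recurse; a relation d among the cleared rows lifts to (d ∙ vⱼ₀) ∷ d.
>dim⇒linDep : ∀ {m k} → m < k → (v : Fin k → Vec m) → LinDep v
>dim⇒linDep {zero}  {suc k} _         v = δ zero , (zero , refl) , λ ()
>dim⇒linDep {suc m} {suc k} (s≤s m<k) v with any? (λ j → v zero j Bool.≟ true)
... | no  v₀≢1          = δ zero , (zero , refl) , λ j → trans (lincomb-δ v zero j) (¬-not (v₀≢1 ∘ (j ,_)))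
... | yes (j₀ , v₀ⱼ₀≡1) = lift (>dim⇒linDep m<k (λ i → cleared i ∘ punchIn j₀))
  where
  cleared : Fin k → Vec (suc m)
  cleared i = v (suc i) +ᵥ (v (suc i) j₀ ·ᵥ v zero)

  cleared-j₀ : ∀ i → cleared i j₀ ≡ false
  cleared-j₀ i = begin
    x xor (x ∧ v zero j₀) ≡⟨ cong (λ p → x xor (x ∧ p)) v₀ⱼ₀≡1 ⟩
    x xor (x ∧ true)      ≡⟨ cong (x xor_) (∧-identityʳ x) ⟩
    x xor x               ≡⟨ xor-same x ⟩
    false                 ∎
    where
    open ≡-Reasoning
    x = v (suc i) j₀

  lift : LinDep (λ i → cleared i ∘ punchIn j₀) → LinDep v
  lift (d , (i₁ , dᵢ₁≡1) , rel) = (d ∙ (λ i → v (suc i) j₀)) ∷ d , (suc i₁ , dᵢ₁≡1) , rel′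
    where
    rel′ : ∀ j → lincomb ((d ∙ (λ i → v (suc i) j₀)) ∷ d) v j ≡ false
    rel′ j with j₀ ≟ j
    ... | yes refl = trans (sym (lincomb-shear d _ (v zero) (v ∘ suc) j₀))
                           (∑-zero (λ i → trans (cong (d i ∧_) (cleared-j₀ i)) (∧-zeroʳ (d i))))
    ... | no j₀≢j  = trans (sym (lincomb-shear d _ (v zero) (v ∘ suc) j))
                           (subst (λ j → lincomb d cleared j ≡ false) (punchIn-punchOut j₀≢j) (rel (punchOut j₀≢j)))

linDep-inSpan : ∀ {n m k} → m < k → {v : Fin k → Vec n} (w : Fin m → Vec n) (C : Fin k → Vec m) →
                (∀ i → v i ≈ᵥ lincomb (C i) w) → LinDep v
linDep-inSpan m<k {v} w C v≈Cw with >dim⇒linDep m<k C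
... | c , nonzero , cC≈0 = c , nonzero , λ l → begin
  lincomb c v l                       ≡⟨ lincomb-congʳ c v≈Cw l ⟩
  lincomb c (λ i → lincomb (C i) w) l ≡⟨ lincomb-assoc c C w l ⟩
  lincomb (lincomb c C) w l           ≡⟨ lincomb-zeroˡ w cC≈0 l ⟩
  false                               ∎
  where open ≡-Reasoning

¬hasIndep-suc : ∀ {n} {W : VSet n} → ¬ HasIndep W (suc n)
¬hasIndep-suc (v , _ , indep) = linDep⇒¬linIndep {v = v} (>dim⇒linDep ≤-refl v) indep

linIndep⇒spans : ∀ {n m} {v : Fin m → Vec n} (w : Fin m → Vec n) (C : Fin m → Vec m) →
                 (∀ i → v i ≈ᵥ lincomb (C i) w) → LinIndep v → ∀ j → Σ (Vec m) λ d → w j ≈ᵥ lincomb d v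
linIndep⇒spans {v = v} w C v≈Cw indep j
  with linDep-inSpan ≤-refl {w j ∷ v} w (δ j ∷ C) (λ { zero → sym ∘ lincomb-δ w j ; (suc i) → v≈Cw i })
... | c , (i₀ , cᵢ₀≡1) , rel = c ∘ suc , λ l → xor≡false⇒≡ (rel-at c₀≡1 l)
  where
  rel-at : ∀ {b} → c zero ≡ b → ∀ l → (b ∧ w j l) xor lincomb (c ∘ suc) v l ≡ false
  rel-at refl = rel

  xor≡false⇒≡ : ∀ {x y} → x xor y ≡ false → x ≡ y
  xor≡false⇒≡ {false} x⊕y≡0 = sym x⊕y≡0
  xor≡false⇒≡ {true} {true} _ = refl

  c₀≡1 : c zero ≡ true
  c₀≡1 = ¬-not λ c₀≡0 →
    let c≡0 : ∀ i → c i ≡ false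
        c≡0 = λ { zero → c₀≡0 ; (suc i) → indep (c ∘ suc) (rel-at c₀≡0) i }
    in contradiction (trans (sym cᵢ₀≡1) (c≡0 i₀)) λ ()

alt : Bool → Bool → Bool → Mat 4
alt a b c = (false ∷ a     ∷ b     ∷ false ∷ [])
          ∷ (a     ∷ false ∷ c     ∷ false ∷ [])
          ∷ (b     ∷ c     ∷ false ∷ false ∷ [])
          ∷ (false ∷ false ∷ false ∷ false ∷ [])
          ∷ []

𝓐 : Mat 4 → Set
𝓐 B = Σ Bool λ a → Σ Bool λ b → Σ Bool λ c → B ≈ₘ alt a b c

E₀₁ E₀₂ E₁₂ : Mat 4
E₀₁ = alt true false false
E₀₂ = alt false true false
E₁₂ = alt false false true

E₀₁∈𝓐 : 𝓐 E₀₁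
E₀₁∈𝓐 = true , false , false , λ _ _ → refl

E₀₂∈𝓐 : 𝓐 E₀₂
E₀₂∈𝓐 = false , true , false , λ _ _ → refl

E₁₂∈𝓐 : 𝓐 E₁₂
E₁₂∈𝓐 = false , false , true , λ _ _ → refl

+ᵥ-∷₄ : ∀ {w x y z w′ x′ y′ z′} → ((w ∷ x ∷ y ∷ z ∷ []) +ᵥ (w′ ∷ x′ ∷ y′ ∷ z′ ∷ []))
                                  ≈ᵥ ((w xor w′) ∷ (x xor x′) ∷ (y xor y′) ∷ (z xor z′) ∷ [])
+ᵥ-∷₄ 0F = refl
+ᵥ-∷₄ 1F = refl
+ᵥ-∷₄ 2F = refl
+ᵥ-∷₄ 3F = refl

alt-+ : ∀ a b c a′ b′ c′ → (alt a b c +ₘ alt a′ b′ c′) ≈ₘ alt (a xor a′) (b xor b′) (c xor c′)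
alt-+ _ _ _ _ _ _ 0F = +ᵥ-∷₄
alt-+ _ _ _ _ _ _ 1F = +ᵥ-∷₄
alt-+ _ _ _ _ _ _ 2F = +ᵥ-∷₄
alt-+ _ _ _ _ _ _ 3F = +ᵥ-∷₄

𝓐-isMatrixSpace : IsMatrixSpace 𝓐
𝓐-isMatrixSpace = record { resp = resp ; zero∈ = zero∈ ; +-closed = +-closed ; ·-closed = ·-closed }
  where
  resp : ∀ {A B} → A ≈ₘ B → 𝓐 A → 𝓐 B
  resp A≈B (a , b , c , A≈alt) = a , b , c , λ i j → trans (sym (A≈B i j)) (A≈alt i j)

  +-closed : ∀ {A B} → 𝓐 A → 𝓐 B → 𝓐 (A +ₘ B)
  +-closed (a , b , c , A≈alt) (a′ , b′ , c′ , B≈alt) =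
    a xor a′ , b xor b′ , c xor c′ , λ i j →
      trans (cong₂ _xor_ (A≈alt i j) (B≈alt i j)) (alt-+ a b c a′ b′ c′ i j)

  -- over GF(2), 0 = A + A and the only scalars are 0 and 1
  zero∈ : 𝓐 0ₘ
  zero∈ = resp (λ i j → xor-same (alt false false false i j)) (+-closed 0∈ 0∈)
    where 0∈ = false , false , false , λ _ _ → refl

  ·-closed : ∀ x {A} → 𝓐 A → 𝓐 (x ·ₘ A)
  ·-closed true  A∈𝓐 = resp (λ _ _ → refl) A∈𝓐
  ·-closed false _   = resp (λ _ _ → refl) zero∈

e₃ : Vec 4
e₃ = e 3F

⟨e₃⟩ : VSet 4
⟨e₃⟩ x = Σ Bool λ t → x ≈ᵥ (t ·ᵥ e₃)

⟨e₃⟩-isSubspace : IsSubspace ⟨e₃⟩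
⟨e₃⟩-isSubspace = record
  { resp     = λ v≈w (t , v≈te₃) → t , λ i → trans (sym (v≈w i)) (v≈te₃ i)
  ; zero∈    = false , λ _ → refl
  ; +-closed = λ (t , v≈te₃) (t′ , w≈t′e₃) → t xor t′ , λ i →
                 trans (cong₂ _xor_ (v≈te₃ i) (w≈t′e₃ i)) (sym (∧-distribʳ-xor (e₃ i) t t′))
  ; ·-closed = λ a (t , v≈te₃) → a ∧ t , λ i → trans (cong (a ∧_) (v≈te₃ i)) (sym (∧-assoc a t (e₃ i)))
  }

⟨e₃⟩-dim₁ : IsDim ⟨e₃⟩ 1
⟨e₃⟩-dim₁ = ((λ _ → e₃) , (λ _ → true , λ _ → refl)
            , pivots⇒linIndep (λ _ → e₃) (λ _ → 3F) λ { 0F 0F → refl })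
          , λ (v , v∈ , indep) → linDep⇒¬linIndep {v = v}
              (linDep-inSpan (s≤s (s≤s z≤n)) (λ _ → e₃) (λ i _ → proj₁ (v∈ i))
                 (λ i l → trans (proj₂ (v∈ i) l) (sym (xor-identityʳ _))))
              indep

alt-col₃ : ∀ a b c i → alt a b c i 3F ≡ false
alt-col₃ _ _ _ 0F = refl
alt-col₃ _ _ _ 1F = refl
alt-col₃ _ _ _ 2F = refl
alt-col₃ _ _ _ 3F = refl

𝓐-kills-⟨e₃⟩ : ∀ {B u} → 𝓐 B → ⟨e₃⟩ u → (B ⟨$⟩ u) ≈ᵥ 0ᵥ
𝓐-kills-⟨e₃⟩ {B} {u} (a , b , c , B≈alt) (t , u≈te₃) = ⟨$⟩-≈0 {A = B} {u} λ where
  i 0F → inj₂ (trans (u≈te₃ 0F) (∧-zeroʳ t))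
  i 1F → inj₂ (trans (u≈te₃ 1F) (∧-zeroʳ t))
  i 2F → inj₂ (trans (u≈te₃ 2F) (∧-zeroʳ t))
  i 3F → inj₁ (trans (B≈alt i 3F) (alt-col₃ a b c i))

⟨e₃⟩-witness : IsWitness 𝓐 ⟨e₃⟩ 1
⟨e₃⟩-witness = ⟨e₃⟩-isSubspace , 1 , 0 , ⟨e₃⟩-dim₁ , 𝓐⟨e₃⟩-dim₀ , ≤-refl
  where
  𝓐⟨e₃⟩-dim₀ : IsDim (Apply 𝓐 ⟨e₃⟩) 0
  𝓐⟨e₃⟩-dim₀ = hasIndep-zero {W = Apply 𝓐 ⟨e₃⟩}
             , ¬hasIndep-zeroSpace {W = Apply 𝓐 ⟨e₃⟩} (apply-≈0 𝓐-kills-⟨e₃⟩)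

E₀₁-hasIndep₂ : HasIndep (Image E₀₁) 2
E₀₁-hasIndep₂ = images , (λ { 0F → e 0F , λ _ → refl ; 1F → e 1F , λ _ → refl })
          , pivots⇒linIndep images (1F ∷ 0F ∷ []) λ { 0F 0F → refl ; 0F 1F → refl ; 1F 0F → refl ; 1F 1F → refl }
  where
  images : Fin 2 → Vec 4
  images = E₀₁ ⟨$⟩ e 0F ∷ E₀₁ ⟨$⟩ e 1F ∷ []

alt-zero : ∀ {a b c} → a ≡ false → b ≡ false → c ≡ false → ∀ x → (alt a b c ⟨$⟩ x) ≈ᵥ 0ᵥ
alt-zero refl refl refl x = λ { 0F → refl ; 1F → refl ; 2F → refl ; 3F → refl }

-- alt a b c is symmetric and kills (c, b, a, 0), so that vector is orthogonal to its image.
alt-image-⊥ : ∀ a b c x → (c ∷ b ∷ a ∷ false ∷ []) ∙ (alt a b c ⟨$⟩ x) ≡ false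
alt-image-⊥ a b c x = identity a b c (x 0F) (x 1F) (x 2F)
  where
  -- the statement above with both sums unfolded
  identity : ∀ a b c x₀ x₁ x₂ →
    c ∧ (a ∧ x₁ xor (b ∧ x₂ xor false)) xor (b ∧ (a ∧ x₀ xor (c ∧ x₂ xor false))
      xor (a ∧ (b ∧ x₀ xor (c ∧ x₁ xor false)) xor false)) ≡ false
  identity = solve-∀ 𝔽₂

𝓐-rank≤2 : ∀ {B} → 𝓐 B → ¬ HasIndep (Image B) 3
𝓐-rank≤2 (a , b , c , B≈alt) (y , y∈Im , indep) = linIndep⇒≉0ᵥ {v = y} indep 0F y₀≈0
  where
  x : Fin 3 → Vec 4
  x i = proj₁ (y∈Im i)

  y≈alt : ∀ i → y i ≈ᵥ (alt a b c ⟨$⟩ x i)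
  y≈alt i l = trans (proj₂ (y∈Im i) l) (⟨$⟩-congˡ B≈alt (x i) l)

  k : Vec 4
  k = c ∷ b ∷ a ∷ false ∷ []

  k⊥ : IsSubspace (λ v → k ∙ v ≡ false)
  k⊥ = orthogonal-isSubspace k

  k⊥y : ∀ i → k ∙ y i ≡ false
  k⊥y i = trans (∑-cong (λ l → cong (k l ∧_) (y≈alt i l))) (alt-image-⊥ a b c (x i))

  -- y₀, y₁, y₂ lie in the hyperplane x₃ = 0, so e₃ together with them spans everything
  spans : ∀ j → Σ (Vec 4) λ d → e j ≈ᵥ lincomb d (e₃ ∷ y)
  spans = linIndep⇒spans e (e₃ ∷ y) (λ i → sym ∘ lincomb-basis ((e₃ ∷ y) i))
                         (∷-linIndep {v = y} 3F refl (λ i → y≈alt i 3F) indep)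

  e⊥k : ∀ j → k ∙ e j ≡ false
  e⊥k j = IsSubspace.resp k⊥ {lincomb d (e₃ ∷ y)} {e j} (sym ∘ proj₂ (spans j))
            (lincomb∈ k⊥ d {e₃ ∷ y} λ { 0F → ∙-basis k 3F ; (suc i) → k⊥y i })
    where d = proj₁ (spans j)

  k≡0 : ∀ j → k j ≡ false
  k≡0 j = trans (sym (∙-basis k j)) (e⊥k j)

  y₀≈0 : y 0F ≈ᵥ 0ᵥ
  y₀≈0 l = trans (y≈alt 0F l) (alt-zero (k≡0 2F) (k≡0 1F) (k≡0 0F) (x 0F) l)

𝓐-cork : IsCork 𝓐 2
𝓐-cork = 2 , ((E₀₁ , E₀₁∈𝓐 , E₀₁-hasIndep₂ , 𝓐-rank≤2 E₀₁∈𝓐)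
             , λ B r B∈𝓐 (hasIndepʳ , _) → hasIndep-bound {W = Image B} hasIndepʳ (𝓐-rank≤2 B∈𝓐))
         , refl

⟨e₃⟩-dichotomy : ∀ x → ⟨e₃⟩ x ⊎ (x 0F ≡ true ⊎ x 1F ≡ true ⊎ x 2F ≡ true)
⟨e₃⟩-dichotomy x with x 0F in x₀ | x 1F in x₁ | x 2F in x₂
... | true  | _     | _     = inj₂ (inj₁ refl)
... | false | true  | _     = inj₂ (inj₂ (inj₁ refl))
... | false | false | true  = inj₂ (inj₂ (inj₂ refl))
... | false | false | false = inj₁ (x 3F , λ where
  0F → trans x₀ (sym (∧-zeroʳ (x 3F)))
  1F → trans x₁ (sym (∧-zeroʳ (x 3F)))
  2F → trans x₂ (sym (∧-zeroʳ (x 3F)))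
  3F → sym (∧-identityʳ (x 3F)))

-- E_{jk} u = u_k e_j + u_j e_k, so if u_j = 1 the images of u under E_{jk} and E_{jl}
-- ({j, k, l} = {0, 1, 2}) have pivots at k and l; those entries compute to u_j xor 0.
support⇒hasIndep₂ : ∀ {U u} → U u → (u 0F ≡ true ⊎ u 1F ≡ true ⊎ u 2F ≡ true) → HasIndep (Apply 𝓐 U) 2
support⇒hasIndep₂ {u = u} u∈U (inj₁ u₀≡1) =
  pivots⇒hasIndep-apply (E₀₁ ∷ E₀₂ ∷ []) (λ _ → u) (λ { 0F → E₀₁∈𝓐 ; 1F → E₀₂∈𝓐 }) (λ _ → u∈U)
    (1F ∷ 2F ∷ []) λ where
      0F 0F → cong (_xor false) u₀≡1 ; 0F 1F → refl
      1F 0F → refl                   ; 1F 1F → cong (_xor false) u₀≡1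
support⇒hasIndep₂ {u = u} u∈U (inj₂ (inj₁ u₁≡1)) =
  pivots⇒hasIndep-apply (E₀₁ ∷ E₁₂ ∷ []) (λ _ → u) (λ { 0F → E₀₁∈𝓐 ; 1F → E₁₂∈𝓐 }) (λ _ → u∈U)
    (0F ∷ 2F ∷ []) λ where
      0F 0F → cong (_xor false) u₁≡1 ; 0F 1F → refl
      1F 0F → refl                   ; 1F 1F → cong (_xor false) u₁≡1
support⇒hasIndep₂ {u = u} u∈U (inj₂ (inj₂ u₂≡1)) =
  pivots⇒hasIndep-apply (E₀₂ ∷ E₁₂ ∷ []) (λ _ → u) (λ { 0F → E₀₂∈𝓐 ; 1F → E₁₂∈𝓐 }) (λ _ → u∈U)
    (0F ∷ 1F ∷ []) λ where
      0F 0F → cong (_xor false) u₂≡1 ; 0F 1F → refl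
      1F 0F → refl                   ; 1F 1F → cong (_xor false) u₂≡1

𝓐-hasIndep₂ : ∀ {U} → HasIndep U 2 → HasIndep (Apply 𝓐 U) 2
𝓐-hasIndep₂ (v , v∈U , indep) with ⟨e₃⟩-dichotomy (v 0F) | ⟨e₃⟩-dichotomy (v 1F)
... | inj₂ v₀∉ | _        = support⇒hasIndep₂ (v∈U 0F) v₀∉
... | inj₁ _   | inj₂ v₁∉ = support⇒hasIndep₂ (v∈U 1F) v₁∉
... | inj₁ v₀∈ | inj₁ v₁∈ = ⊥-elim (proj₂ ⟨e₃⟩-dim₁ (v , (λ { 0F → v₀∈ ; 1F → v₁∈ }) , indep))

𝓐-hasIndep₃ : ∀ {U} → IsSubspace U → HasIndep U 4 → HasIndep (Apply 𝓐 U) 3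
𝓐-hasIndep₃ {U} U≤ (v , v∈U , indep) =
  pivots⇒hasIndep-apply (E₀₁ ∷ E₀₁ ∷ E₀₂ ∷ []) (e 0F ∷ e 1F ∷ e 0F ∷ [])
    (λ { 0F → E₀₁∈𝓐 ; 1F → E₀₁∈𝓐 ; 2F → E₀₂∈𝓐 }) (λ { 0F → e∈U 0F ; 1F → e∈U 1F ; 2F → e∈U 0F })
    (1F ∷ 0F ∷ 2F ∷ []) λ where
      0F 0F → refl ; 0F 1F → refl ; 0F 2F → refl
      1F 0F → refl ; 1F 1F → refl ; 1F 2F → refl
      2F 0F → refl ; 2F 1F → refl ; 2F 2F → refl
  where
  e∈U : ∀ j → U (e j)
  e∈U j = IsSubspace.resp U≤ (sym ∘ proj₂ spanned) (lincomb∈ U≤ (proj₁ spanned) v∈U)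
    where spanned = linIndep⇒spans e v (λ i → sym ∘ lincomb-basis (v i)) indep j

𝓐-dim-drop : ∀ {U j} → IsSubspace U → HasIndep U (suc j) → HasIndep (Apply 𝓐 U) j
𝓐-dim-drop {U} {0} _  _ = hasIndep-zero {W = Apply 𝓐 U}
𝓐-dim-drop {U} {1} _  h = hasIndep-pred {W = Apply 𝓐 U} (𝓐-hasIndep₂ h)
𝓐-dim-drop {U} {2} _  h = 𝓐-hasIndep₂ (hasIndep-pred {W = U} h)
𝓐-dim-drop {U} {3} U≤ h = 𝓐-hasIndep₃ U≤ h
𝓐-dim-drop {U} {suc (suc (suc (suc j)))} _ h =
  ⊥-elim (¬hasIndep-suc {W = U} (hasIndep-antitone {W = U} (s≤s (s≤s (s≤s (s≤s (s≤s z≤n))))) h))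

𝓐-disc≤1 : ∀ {c} → HasWitness 𝓐 c → c ≤ 1
𝓐-disc≤1 {c} (U , U≤ , du , db , (hasIndepᵘ , _) , (_ , ¬hasIndepᵇ) , db+c≤du) =
  +-cancelˡ-≤ db c 1 (≤-trans db+c≤du (≤-trans (du≤1+db du hasIndepᵘ) (≤-reflexive (ℕ.+-comm 1 db))))
  where
  du≤1+db : ∀ d → HasIndep U d → d ≤ suc db
  du≤1+db zero    _ = z≤n
  du≤1+db (suc j) h = s≤s (hasIndep-bound {W = Apply 𝓐 U} (𝓐-dim-drop U≤ h) ¬hasIndepᵇ)

𝓐-disc : IsDisc 𝓐 1
𝓐-disc = (⟨e₃⟩ , ⟨e₃⟩-witness) , λ _ → 𝓐-disc≤1

proposition6 : Σ Field λ F → Σ ℕ λ n → Σ (LinAlg.Mat F n → Set) λ 𝓑 →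
    LinAlg.IsMatrixSpace F 𝓑 × LinAlg.EdmondsRado F 𝓑 × ¬ LinAlg.IsCompression F 𝓑
proposition6 = GF₂ , 4 , 𝓐 , 𝓐-isMatrixSpace , inj₂ (1 , ≤-refl , ⟨e₃⟩ , ⟨e₃⟩-witness) , not-compression
  where
  not-compression : ¬ IsCompression 𝓐
  not-compression compression = 1+n≢n (compression 2 1 𝓐-cork 𝓐-disc)
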